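{- In the setting described in the context, the minimum number of bins of a feasible BPUP solution for the rounded instance $I'$ is at most $\mathrm{OPT}$, the minimum number of bins of a feasible BPUP solution for the original instance $I$.
   Context: BPUP: an instance $I$ has items $\mathcal{I}$ with sizes $s_i\in[0,1]$, a rational $U\in(0,1]$, a positive integer $k$, bins of capacity $1$; the load of a nonempty set $p$ in one bin is $\sum_{i\in p}s_i+\lfloor(|p|-1)/k\rfloor U$; a feasible solution partitions the items into bins of load at most $1$, minimizing the number of bins. Let $\varepsilon>0$ with $1/\varepsilon\in\mathbb{Z}$ and assume $\lfloor k/U\rfloor+k>1/\varepsilon^2$. An item is small if its size is less than $\varepsilon$ and large otherwise; let $\mathcal{S}$ and $\mathcal{L}$ be the sets of small and large items. Sort $\mathcal{L}$ in non-increasing size order (ties arbitrary) and split it into $1/\varepsilon^3$ classes $\mathcal{L}_1,\dots,\mathcal{L}_{1/\varepsilon^3}$ of consecutive items with $\lceil\varepsilon^3|\mathcal{L}|\rceil=|\mathcal{L}_1|\ge|\mathcal{L}_2|\ge\dots\ge|\mathcal{L}_{1/\varepsilon^3}|=\lfloor\varepsilon^3|\mathcal{L}|\rfloor$. The rounded instance $I'$ (same $U$, $k$) consists of the items of $\mathcal{S}$ with their original sizes and the items of $\mathcal{L}\setminus\mathcal{L}_1$, where each item of $\mathcal{L}_i$ ($i\ge2$) has its size rounded up to the largest size in $\mathcal{L}_i$.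
   Formalization: The item sizes $s_i$ take rational values in [0,1]. -}

module Defs where

open import Data.Nat as ℕ using (ℕ; zero; suc; _∸_; _^_; NonZero)
open import Data.Nat.Properties using (m^n≢0)
open import Data.Integer as ℤ using (ℤ; +_)
open import Data.Rational as ℚ using (ℚ; 0ℚ; 1ℚ; _+_; _*_; _≤_; _<_; _÷_; _⊔_; floor; ceiling; Positive)
open import Data.Rational.Properties using (pos⇒nonZero; _<?_)
open import Data.Fin as Fin using (Fin; toℕ; _≟_)
open import Data.List as List using (List; []; _∷_; map; filter; length; foldr; allFin; upTo; replicate; concatMap; _++_)
open import Data.Product using (Σ; Σ-syntax; ∃; ∃-syntax; _×_; _,_)
open import Relation.Nullary using (¬_)
open import Relation.Binary.PropositionalEquality using (_≡_)
open import Relation.Nullary.Decidable using (_×-dec_)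
open import Data.Nat.Properties as ℕP using ()

sumℚ : List ℚ → ℚ
sumℚ = foldr _+_ 0ℚ

sumℕ : List ℕ → ℕ
sumℕ = foldr ℕ._+_ 0

binItems : {n m : ℕ} → (Fin n → Fin m) → Fin m → List (Fin n)
binItems {n} a b = filter (λ i → a i ≟ b) (allFin n)

load : (U : ℚ) (k : ℕ) .{{_ : NonZero k}} {n m : ℕ} →
       (Fin n → ℚ) → (Fin n → Fin m) → Fin m → ℚ
load U k s a b =
  sumℚ (map s (binItems a b))
    + (+ ((length (binItems a b) ∸ 1) ℕ./ k) ℚ./ 1) * U

Feasible : (U : ℚ) (k : ℕ) .{{_ : NonZero k}} {n : ℕ} → (Fin n → ℚ) → ℕ → Set
Feasible U k {n} s m = Σ[ a ∈ (Fin n → Fin m) ] (∀ b → load U k s a b ≤ 1ℚ)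

ε : (q : ℕ) .{{_ : NonZero q}} → ℚ
ε q = + 1 ℚ./ q

Small : (q : ℕ) .{{_ : NonZero q}} → ℚ → Set
Small q x = x < ε q

Large : (q : ℕ) .{{_ : NonZero q}} → ℚ → Set
Large q x = ¬ (x < ε q)

floorKU : (k : ℕ) (U : ℚ) .{{_ : Positive U}} → ℤ
floorKU k U = floor (_÷_ (+ k ℚ./ 1) U {{pos⇒nonZero U}})

perClass : (q : ℕ) .{{_ : NonZero q}} → ℕ → ℚ
perClass q ℓ = ℚ._/_ (+ ℓ) (q ^ 3) {{m^n≢0 q 3}}

record LargeOrder (q : ℕ) .{{_ : NonZero q}} {n : ℕ} (s : Fin n → ℚ) : Set where
  field
    ℓ        : ℕ
    σ        : Fin ℓ → Fin n
    σ-inj    : ∀ j j' → σ j ≡ σ j' → j ≡ j'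
    σ-large  : ∀ j → Large q (s (σ j))
    σ-onto   : ∀ i → Large q (s i) → ∃[ j ] (σ j ≡ i)
    σ-sorted : ∀ j j' → toℕ j ℕ.≤ toℕ j' → s (σ j') ≤ s (σ j)

-- Sizes of the 1/ε³ = q³ classes of consecutive positions; class number
-- i (0-based, i < q³) is the paper's class L_{i+1}.
record ClassSizes (q : ℕ) .{{_ : NonZero q}} (ℓ : ℕ) (c : ℕ → ℕ) : Set where
  field
    first  : + (c 0) ≡ ceiling (perClass q ℓ)
    last   : + (c (q ^ 3 ∸ 1)) ≡ floor (perClass q ℓ)
    noninc : ∀ i → suc i ℕ.< q ^ 3 → c (suc i) ℕ.≤ c i
    total  : sumℕ (map c (upTo (q ^ 3))) ≡ ℓ

start : (c : ℕ → ℕ) → ℕ → ℕ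
start c i = sumℕ (map c (upTo i))

classPositions : (c : ℕ → ℕ) (ℓ : ℕ) → ℕ → List (Fin ℓ)
classPositions c ℓ i =
  filter (λ j → (start c i ℕP.≤? toℕ j) ×-dec (toℕ j ℕP.<? start c i ℕ.+ c i)) (allFin ℓ)

-- the largest size in a list of sizes (0 for the empty list; sizes are ≥ 0)
maxℚ : List ℚ → ℚ
maxℚ = foldr _⊔_ 0ℚ

-- the rounded instance I' as the list of its item sizes:
-- the small items with their original sizes, followed by, for every class
-- L_i with i ≥ 2, |L_i| items whose size is the largest size in L_i.
rounded : (q : ℕ) .{{_ : NonZero q}} {n : ℕ} (s : Fin n → ℚ) →
          LargeOrder q s → (ℕ → ℕ) → List ℚ
rounded q {n} s ord c =
  map s (filter (λ i → s i <? ε q) (allFin n))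
  ++ concatMap (λ i → replicate (c i) (maxℚ (map (λ j → s (σ j)) (classPositions c ℓ i))))
               (map suc (upTo (q ^ 3 ∸ 1)))
  where open LargeOrder ord

module Submission where

-- Match every small item of I' with itself and the j-th
-- rounded large item (classes L₂, L₃, … in order) with the j-th largest item
-- of I.  An item of L_{i+1} is rounded to the largest size in L_{i+1}, which
-- is at most the size of every item preceding L_{i+1} in the sorted order;
-- since |L_{i+1}| ≤ |L_i|, the rounded items of L₂ … L_{i+1} never outnumber
-- the items of L₁ … L_i, so each is matched with such a preceding item.  This
-- injection from I' into I does not increase sizes, so pulling a packing of I
-- back along it leaves in every bin at most as many items as before, each no
-- larger than its partner, and the load can only drop.

open import Defs
open import Data.Nat as ℕ using (ℕ; zero; suc; _∸_; _^_; NonZero; z≤n)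
import Data.Nat.Properties as ℕP
import Data.Nat.DivMod as ℕD
import Data.Nat.Coprimality as Coprime
open import Data.Nat.ListAction.Properties using (sum-++)
open import Data.Integer as ℤ using (+_)
import Data.Integer.Properties as ℤP
open import Data.Rational as ℚ using (ℚ; 0ℚ; 1ℚ; _≤_; Positive; *≤*)
import Data.Rational.Properties as ℚP
open import Data.Fin as Fin using (Fin; toℕ; fromℕ<; _≟_; cast)
open import Data.Fin.Properties using (toℕ-cast; toℕ-injective; toℕ-fromℕ<)
open import Data.List as List
  using (List; []; _∷_; _++_; _∷ʳ_; map; filter; length; lookup; allFin; upTo; replicate; concatMap)
import Data.List.Properties as LP
open import Data.List.Membership.Propositional using (_∈_)
open import Data.List.Membership.Propositional.Properties
  using (∈-∃++; ∈-map⁻; ∈-filter⁻; ∈-filter⁺; ∈-allFin; ∈-lookup)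
open import Data.List.Relation.Binary.Subset.Propositional using (_⊆_)
open import Data.List.Relation.Binary.Disjoint.Propositional using (Disjoint)
open import Data.List.Relation.Binary.Permutation.Propositional
  using (_↭_; ↭-refl; ↭-trans; prep; ↭⇒↭ₛ)
open import Data.List.Relation.Binary.Permutation.Propositional.Properties
  using (shift; ↭-length) renaming (map⁺ to ↭-map⁺)
open import Data.List.Relation.Binary.Permutation.Setoid.Properties using (foldr-commMonoid)
open import Data.List.Relation.Binary.Pointwise as Pointwise using (Pointwise; []; _∷_)
open import Data.List.Relation.Unary.All as All using (All; []; _∷_)
import Data.List.Relation.Unary.All.Properties as All
open import Data.List.Relation.Unary.Any using (here; there)
open import Data.List.Relation.Unary.AllPairs using ([]; _∷_)
open import Data.List.Relation.Unary.Unique.Propositional using (Unique)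
import Data.List.Relation.Unary.Unique.Propositional.Properties as Unique
open import Data.Product using (_×_; ∃-syntax; _,_; proj₁; proj₂)
open import Data.Empty using (⊥-elim)
open import Function using (_∘_; id)
open import Relation.Nullary using (yes; no; contradiction)
open import Relation.Binary.PropositionalEquality

∈-++-∷⁻ : ∀ {A : Set} (xs : List A) {ys} {x y : A} → x ≢ y → y ∈ xs ++ x ∷ ys → y ∈ xs ++ ys
∈-++-∷⁻ []       x≢y (here y≡x) = ⊥-elim (x≢y (sym y≡x))
∈-++-∷⁻ []       x≢y (there y∈) = y∈
∈-++-∷⁻ (_ ∷ xs) x≢y (here y≡z) = here y≡z
∈-++-∷⁻ (_ ∷ xs) x≢y (there y∈) = there (∈-++-∷⁻ xs x≢y y∈)

Unique-⊆⇒↭++ : ∀ {A : Set} {xs ys : List A} → Unique xs → xs ⊆ ys → ∃[ zs ] ys ↭ xs ++ zs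
Unique-⊆⇒↭++ {xs = []}     _            _       = _ , ↭-refl
Unique-⊆⇒↭++ {xs = x ∷ xs} (x∉xs ∷ uxs) x∷xs⊆ys with ∈-∃++ (x∷xs⊆ys (here refl))
... | as , bs , refl with Unique-⊆⇒↭++ uxs xs⊆as++bs
  where
  xs⊆as++bs : xs ⊆ as ++ bs
  xs⊆as++bs y∈xs = ∈-++-∷⁻ as (All.lookup x∉xs y∈xs) (x∷xs⊆ys (there y∈xs))
... | zs , as++bs↭xs++zs = zs , ↭-trans (shift x as bs) (prep x as++bs↭xs++zs)

Unique-⊆⇒length≤ : ∀ {A : Set} {xs ys : List A} → Unique xs → xs ⊆ ys → length xs ℕ.≤ length ys
Unique-⊆⇒length≤ {xs = xs} uxs xs⊆ys with Unique-⊆⇒↭++ uxs xs⊆ys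
... | zs , ys↭xs++zs =
  ℕP.≤-trans (LP.length-++-≤ˡ xs) (ℕP.≤-reflexive (sym (↭-length ys↭xs++zs)))

lookup-injective : ∀ {A : Set} {xs : List A} → Unique xs →
                   ∀ {i j} → lookup xs i ≡ lookup xs j → i ≡ j
lookup-injective (_    ∷ _)   {Fin.zero}  {Fin.zero}  _  = refl
lookup-injective (x∉xs ∷ _)   {Fin.zero}  {Fin.suc j} eq = ⊥-elim (All.lookup x∉xs (∈-lookup j) eq)
lookup-injective (x∉xs ∷ _)   {Fin.suc i} {Fin.zero}  eq = ⊥-elim (All.lookup x∉xs (∈-lookup i) (sym eq))
lookup-injective (_    ∷ uxs) {Fin.suc i} {Fin.suc j} eq = cong Fin.suc (lookup-injective uxs eq)

sumℚ-++ : ∀ xs ys → sumℚ (xs ++ ys) ≡ sumℚ xs ℚ.+ sumℚ ys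
sumℚ-++ []       ys = sym (ℚP.+-identityˡ (sumℚ ys))
sumℚ-++ (x ∷ xs) ys =
  trans (cong (x ℚ.+_) (sumℚ-++ xs ys)) (sym (ℚP.+-assoc x (sumℚ xs) (sumℚ ys)))

sumℚ-↭ : ∀ {xs ys} → xs ↭ ys → sumℚ xs ≡ sumℚ ys
sumℚ-↭ p = foldr-commMonoid (setoid ℚ) ℚP.+-0-isCommutativeMonoid (↭⇒↭ₛ p)

sumℚ-map-nonNeg : ∀ {A : Set} {g : A → ℚ} → (∀ x → 0ℚ ≤ g x) →
                  ∀ xs → 0ℚ ≤ sumℚ (map g xs)
sumℚ-map-nonNeg 0≤g []       = ℚP.≤-refl
sumℚ-map-nonNeg 0≤g (x ∷ xs) = ℚP.+-mono-≤ (0≤g x) (sumℚ-map-nonNeg 0≤g xs)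

sumℚ-map-mono : ∀ {A : Set} {f g : A → ℚ} → (∀ x → f x ≤ g x) →
                ∀ xs → sumℚ (map f xs) ≤ sumℚ (map g xs)
sumℚ-map-mono f≤g []       = ℚP.≤-refl
sumℚ-map-mono f≤g (x ∷ xs) = ℚP.+-mono-≤ (f≤g x) (sumℚ-map-mono f≤g xs)

Unique-⊆⇒sumℚ≤ : ∀ {A : Set} (g : A → ℚ) → (∀ x → 0ℚ ≤ g x) → ∀ {xs ys} →
                 Unique xs → xs ⊆ ys → sumℚ (map g xs) ≤ sumℚ (map g ys)
Unique-⊆⇒sumℚ≤ g 0≤g {xs} {ys} uxs xs⊆ys with Unique-⊆⇒↭++ uxs xs⊆ys
... | zs , ys↭xs++zs = begin
  sumℚ (map g xs)                        ≤⟨ ℚP.≤-reflexive (sym (ℚP.+-identityʳ _)) ⟩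
  sumℚ (map g xs) ℚ.+ 0ℚ                 ≤⟨ ℚP.+-monoʳ-≤ (sumℚ (map g xs)) (sumℚ-map-nonNeg 0≤g zs) ⟩
  sumℚ (map g xs) ℚ.+ sumℚ (map g zs)    ≡⟨ sumℚ-++ (map g xs) (map g zs) ⟨
  sumℚ (map g xs ++ map g zs)            ≡⟨ cong sumℚ (LP.map-++ g xs zs) ⟨
  sumℚ (map g (xs ++ zs))                ≡⟨ sumℚ-↭ (↭-map⁺ g ys↭xs++zs) ⟨
  sumℚ (map g ys)                        ∎
  where open ℚP.≤-Reasoning

+/1-mono-≤ : ∀ {x y : ℕ} → x ℕ.≤ y → (+ x ℚ./ 1) ≤ (+ y ℚ./ 1)
+/1-mono-≤ {x} {y} x≤y
  rewrite ℚP.normalize-coprime {x} {0} (Coprime.sym (Coprime.1-coprimeTo x))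
        | ℚP.normalize-coprime {y} {0} (Coprime.sym (Coprime.1-coprimeTo y))
  = *≤* (ℤP.*-monoʳ-≤-nonNeg (+ 1) (ℤ.+≤+ x≤y))

module _ (U : ℚ) .{{_ : Positive U}} (k : ℕ) .{{_ : NonZero k}} {n n′ : ℕ}
         (s : Fin n → ℚ) (t : Fin n′ → ℚ) (0≤s : ∀ i → 0ℚ ≤ s i)
         (f : Fin n′ → Fin n) (f-inj : ∀ {i j} → f i ≡ f j → i ≡ j)
         (t≤s∘f : ∀ j → t j ≤ s (f j)) where

  map-binItems-⊆ : ∀ {m} (a : Fin n → Fin m) b → map f (binItems (a ∘ f) b) ⊆ binItems a b
  map-binItems-⊆ a b v∈ with ∈-map⁻ f v∈
  ... | j , j∈ , refl =
    ∈-filter⁺ (λ i → a i ≟ b) (∈-allFin (f j))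
              (proj₂ (∈-filter⁻ (λ j → a (f j) ≟ b) {xs = allFin n′} j∈))

  Unique-map-binItems : ∀ {m} (a : Fin n → Fin m) b → Unique (map f (binItems (a ∘ f) b))
  Unique-map-binItems a b =
    Unique.map⁺ f-inj (Unique.filter⁺ (λ j → a (f j) ≟ b) (Unique.allFin⁺ n′))

  load-reindex-≤ : ∀ {m} (a : Fin n → Fin m) b → load U k t (a ∘ f) b ≤ load U k s a b
  load-reindex-≤ a b = ℚP.+-mono-≤ sizes≤ penalty≤
    where
    instance _ = ℚP.pos⇒nonNeg U
    items = binItems (a ∘ f) b
    sizes≤ : sumℚ (map t items) ≤ sumℚ (map s (binItems a b))
    sizes≤ = begin
      sumℚ (map t items)          ≤⟨ sumℚ-map-mono t≤s∘f items ⟩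
      sumℚ (map (s ∘ f) items)    ≡⟨ cong sumℚ (LP.map-∘ items) ⟩
      sumℚ (map s (map f items))  ≤⟨ Unique-⊆⇒sumℚ≤ s 0≤s (Unique-map-binItems a b) (map-binItems-⊆ a b) ⟩
      sumℚ (map s (binItems a b)) ∎
      where open ℚP.≤-Reasoning
    count≤ : length items ℕ.≤ length (binItems a b)
    count≤ = ℕP.≤-trans (ℕP.≤-reflexive (sym (LP.length-map f items)))
                        (Unique-⊆⇒length≤ (Unique-map-binItems a b) (map-binItems-⊆ a b))
    penalty≤ = ℚP.*-monoʳ-≤-nonNeg U (+/1-mono-≤ (ℕD./-monoˡ-≤ k (ℕP.∸-monoˡ-≤ 1 count≤)))

  feasible-reindex : ∀ {m} → Feasible U k s m → Feasible U k t m
  feasible-reindex (a , a-fits) = a ∘ f , λ b → ℚP.≤-trans (load-reindex-≤ a b) (a-fits b)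

Dominated : {n : ℕ} → (Fin n → ℚ) → List ℚ → List (Fin n) → Set
Dominated s = Pointwise (λ r i → r ≤ s i)

map-dominated : ∀ {n} (s : Fin n → ℚ) is → Dominated s (map s is) is
map-dominated s []       = []
map-dominated s (i ∷ is) = ℚP.≤-refl ∷ map-dominated s is

replicate-dominated : ∀ {n} (s : Fin n → ℚ) {v is} → All (λ i → v ≤ s i) is →
                      Dominated s (replicate (length is) v) is
replicate-dominated s []           = []
replicate-dominated s (v≤i ∷ v≤is) = v≤i ∷ replicate-dominated s v≤is

feasible-dominated : (U : ℚ) .{{_ : Positive U}} (k : ℕ) .{{_ : NonZero k}} {n : ℕ}
                     (s : Fin n → ℚ) → (∀ i → 0ℚ ≤ s i) →
                     ∀ {rs is} → Dominated s rs is → Unique is →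
                     ∀ {m} → Feasible U k s m → Feasible U k (lookup rs) m
feasible-dominated U k s 0≤s {rs} {is} rs≼is uis =
  feasible-reindex U k s (lookup rs) 0≤s (lookup is ∘ cast |rs|≡|is|) match-injective
                   (Pointwise.lookup⁺ rs≼is)
  where
  |rs|≡|is| : length rs ≡ length is
  |rs|≡|is| = Pointwise.Pointwise-length rs≼is
  match-injective : ∀ {i j} → lookup is (cast |rs|≡|is| i) ≡ lookup is (cast |rs|≡|is| j) → i ≡ j
  match-injective {i} {j} eq = toℕ-injective (begin
    toℕ i                   ≡⟨ toℕ-cast |rs|≡|is| i ⟨
    toℕ (cast |rs|≡|is| i)  ≡⟨ cong toℕ (lookup-injective uis eq) ⟩
    toℕ (cast |rs|≡|is| j)  ≡⟨ toℕ-cast |rs|≡|is| j ⟩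
    toℕ j                   ∎)
    where open ≡-Reasoning

-- Positions from ℓ on are silently dropped.
interval : {ℓ : ℕ} → ℕ → ℕ → List (Fin ℓ)
interval     b zero      = []
interval {ℓ} b (suc len) with b ℕP.<? ℓ
... | yes b<ℓ = fromℕ< b<ℓ ∷ interval (suc b) len
... | no  _   = []

interval-bounds : ∀ {ℓ} b len →
                  All (λ j → b ℕ.≤ toℕ j × toℕ j ℕ.< b ℕ.+ len) (interval {ℓ} b len)
interval-bounds     b zero      = []
interval-bounds {ℓ} b (suc len) with b ℕP.<? ℓ
... | no  _   = []
... | yes b<ℓ =
  (ℕP.≤-reflexive (sym b≡j) , subst (ℕ._< b ℕ.+ suc len) (sym b≡j) (ℕP.m<m+n b ℕ.z<s))
  ∷ All.map (λ {j} (b<j , j<) → ℕP.<⇒≤ b<j , subst (toℕ j ℕ.<_) (sym (ℕP.+-suc b len)) j<)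
            (interval-bounds (suc b) len)
  where b≡j = toℕ-fromℕ< b<ℓ

Unique-interval : ∀ {ℓ} b len → Unique (interval {ℓ} b len)
Unique-interval     b zero      = []
Unique-interval {ℓ} b (suc len) with b ℕP.<? ℓ
... | no  _   = []
... | yes b<ℓ =
  All.map (λ (b<j , _) b≡j → ℕP.<-irrefl (trans (sym (toℕ-fromℕ< b<ℓ)) (cong toℕ b≡j)) b<j)
          (interval-bounds (suc b) len)
  ∷ Unique-interval (suc b) len

length-interval : ∀ {ℓ} b len → b ℕ.+ len ℕ.≤ ℓ → length (interval {ℓ} b len) ≡ len
length-interval     b zero      _         = refl
length-interval {ℓ} b (suc len) b+len≤ℓ with b ℕP.<? ℓ
... | yes _   = cong suc (length-interval (suc b) len (subst (ℕ._≤ ℓ) (ℕP.+-suc b len) b+len≤ℓ))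
... | no  b≮ℓ = contradiction (ℕP.<-≤-trans (ℕP.m<m+n b ℕ.z<s) b+len≤ℓ) b≮ℓ

interval-++ : ∀ {ℓ} b x y → b ℕ.+ x ℕ.≤ ℓ →
              interval {ℓ} b (x ℕ.+ y) ≡ interval b x ++ interval (b ℕ.+ x) y
interval-++     b zero    y _ = cong (λ b′ → interval b′ y) (sym (ℕP.+-identityʳ b))
interval-++ {ℓ} b (suc x) y b+x≤ℓ with b ℕP.<? ℓ
... | yes b<ℓ = cong (fromℕ< b<ℓ ∷_) (begin
  interval (suc b) (x ℕ.+ y)
    ≡⟨ interval-++ (suc b) x y (subst (ℕ._≤ ℓ) (ℕP.+-suc b x) b+x≤ℓ) ⟩
  interval (suc b) x ++ interval (suc b ℕ.+ x) y
    ≡⟨ cong (λ b′ → interval (suc b) x ++ interval b′ y) (ℕP.+-suc b x) ⟨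
  interval (suc b) x ++ interval (b ℕ.+ suc x) y
    ∎)
  where open ≡-Reasoning
... | no  b≮ℓ = contradiction (ℕP.<-≤-trans (ℕP.m<m+n b ℕ.z<s) b+x≤ℓ) b≮ℓ

start-suc : ∀ c p → start c (suc p) ≡ start c p ℕ.+ c p
start-suc c p = begin
  sumℕ (map c (upTo (suc p)))        ≡⟨ cong (sumℕ ∘ map c) (LP.applyUpTo-∷ʳ id p) ⟨
  sumℕ (map c (upTo p ∷ʳ p))         ≡⟨ cong sumℕ (LP.map-++ c (upTo p) (p ∷ [])) ⟩
  sumℕ (map c (upTo p) ++ c p ∷ [])  ≡⟨ sum-++ (map c (upTo p)) (c p ∷ []) ⟩
  start c p ℕ.+ (c p ℕ.+ 0)          ≡⟨ cong (start c p ℕ.+_) (ℕP.+-identityʳ (c p)) ⟩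
  start c p ℕ.+ c p                  ∎
  where open ≡-Reasoning

start-mono : ∀ c {p p′} → p ℕ.≤′ p′ → start c p ℕ.≤ start c p′
start-mono c ℕ.≤′-refl              = ℕP.≤-refl
start-mono c (ℕ.≤′-step {p′} p≤′p′) =
  ℕP.≤-trans (start-mono c p≤′p′)
             (ℕP.≤-trans (ℕP.m≤m+n _ (c p′)) (ℕP.≤-reflexive (sym (start-suc c p′))))

module LinearGrouping (q : ℕ) .{{_ : NonZero q}} {n : ℕ} (s : Fin n → ℚ) (0≤s : ∀ i → 0ℚ ≤ s i)
                      (ord : LargeOrder q s) (c : ℕ → ℕ) (cs : ClassSizes q (LargeOrder.ℓ ord) c)
                      where
  open LargeOrder ord
  open ClassSizes cs

  start≤ℓ : ∀ p → p ℕ.≤ q ^ 3 → start c p ℕ.≤ ℓ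
  start≤ℓ p p≤q³ = ℕP.≤-trans (start-mono c (ℕP.≤⇒≤′ p≤q³)) (ℕP.≤-reflexive total)

  largest : ℕ → ℚ
  largest i = maxℚ (map (λ j → s (σ j)) (classPositions c ℓ i))

  largest≤ : ∀ i j → toℕ j ℕ.< start c i → largest i ≤ s (σ j)
  largest≤ i j j<start = LP.foldr-preservesᵇ {P = _≤ s (σ j)} ℚP.⊔-lub (0≤s (σ j))
    (All.map⁺ (All.map in-class⇒≤ (All.all-filter _ (allFin ℓ))))
    where
    in-class⇒≤ : ∀ {j′} → start c i ℕ.≤ toℕ j′ × toℕ j′ ℕ.< start c i ℕ.+ c i → s (σ j′) ≤ s (σ j)
    in-class⇒≤ {j′} (start≤j′ , _) = σ-sorted j j′ (ℕP.<⇒≤ (ℕP.<-≤-trans j<start start≤j′))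

  roundedClass : ℕ → List ℚ
  roundedClass i = replicate (c i) (largest i)

  roundedLarge : ℕ → List ℚ
  roundedLarge N = concatMap roundedClass (map suc (upTo N))

  roundedLarge-suc : ∀ N → roundedLarge (suc N) ≡ roundedLarge N ++ roundedClass (suc N)
  roundedLarge-suc N = begin
    concatMap roundedClass (map suc (upTo (suc N)))
      ≡⟨ cong (concatMap roundedClass ∘ map suc) (LP.applyUpTo-∷ʳ id N) ⟨
    concatMap roundedClass (map suc (upTo N ∷ʳ N))
      ≡⟨ cong (concatMap roundedClass) (LP.map-++ suc (upTo N) (N ∷ [])) ⟩
    concatMap roundedClass (map suc (upTo N) ++ suc N ∷ [])
      ≡⟨ LP.concatMap-++ roundedClass (map suc (upTo N)) (suc N ∷ []) ⟩
    roundedLarge N ++ roundedClass (suc N) ++ []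
      ≡⟨ cong (roundedLarge N ++_) (LP.++-identityʳ (roundedClass (suc N))) ⟩
    roundedLarge N ++ roundedClass (suc N)
      ∎
    where open ≡-Reasoning

  firstItems : ℕ → List (Fin n)
  firstItems L = map σ (interval 0 L)

  firstItems-+ : ∀ L x → L ℕ.≤ ℓ → firstItems (L ℕ.+ x) ≡ firstItems L ++ map σ (interval L x)
  firstItems-+ L x L≤ℓ =
    trans (cong (map σ) (interval-++ 0 L x L≤ℓ)) (LP.map-++ σ (interval 0 L) (interval L x))

  roundedClass-dominated : ∀ i b → suc i ℕ.< q ^ 3 → b ℕ.+ c (suc i) ℕ.≤ start c (suc i) →
                           Dominated s (roundedClass (suc i)) (map σ (interval b (c (suc i))))
  roundedClass-dominated i b si<q³ b+c≤start =
    subst (λ len → Dominated s (replicate len (largest (suc i))) positions) |positions|≡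
          (replicate-dominated s (All.map⁺ (All.map below-class (interval-bounds b (c (suc i))))))
    where
    positions = map σ (interval b (c (suc i)))
    |positions|≡ : length positions ≡ c (suc i)
    |positions|≡ = trans (LP.length-map σ (interval b (c (suc i))))
                         (length-interval b (c (suc i))
                                          (ℕP.≤-trans b+c≤start (start≤ℓ (suc i) (ℕP.<⇒≤ si<q³))))
    below-class : ∀ {j} → b ℕ.≤ toℕ j × toℕ j ℕ.< b ℕ.+ c (suc i) → largest (suc i) ≤ s (σ j)
    below-class {j} (_ , j<) = largest≤ (suc i) j (ℕP.<-≤-trans j< b+c≤start)

  PrefixDominated : ℕ → List ℚ → Set
  PrefixDominated N rs = length rs ℕ.≤ start c N × Dominated s rs (firstItems (length rs))

  PrefixDominated-++ : ∀ N {rs} → suc N ℕ.< q ^ 3 → PrefixDominated N rs →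
                       PrefixDominated (suc N) (rs ++ roundedClass (suc N))
  PrefixDominated-++ N {rs} sN<q³ (|rs|≤start , rs≼) = |rs′|≤start , rs′≼
    where
    L = length rs
    rs′ = rs ++ roundedClass (suc N)
    L+c≤start : L ℕ.+ c (suc N) ℕ.≤ start c (suc N)
    L+c≤start = ℕP.≤-trans (ℕP.+-mono-≤ |rs|≤start (noninc N sN<q³))
                           (ℕP.≤-reflexive (sym (start-suc c N)))
    L≤ℓ : L ℕ.≤ ℓ
    L≤ℓ = ℕP.≤-trans (ℕP.m≤m+n L _)
                     (ℕP.≤-trans L+c≤start (start≤ℓ (suc N) (ℕP.<⇒≤ sN<q³)))
    |rs′|≡ : length rs′ ≡ L ℕ.+ c (suc N)
    |rs′|≡ = trans (LP.length-++ rs) (cong (L ℕ.+_) (LP.length-replicate (c (suc N))))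
    |rs′|≤start = ℕP.≤-trans (ℕP.≤-reflexive |rs′|≡) L+c≤start
    rs′≼ : Dominated s rs′ (firstItems (length rs′))
    rs′≼ rewrite |rs′|≡ | firstItems-+ L (c (suc N)) L≤ℓ =
      Pointwise.++⁺ rs≼ (roundedClass-dominated N L sN<q³ L+c≤start)

  roundedLarge-dominated : ∀ N → N ℕ.< q ^ 3 → PrefixDominated N (roundedLarge N)
  roundedLarge-dominated zero    _     = z≤n , []
  roundedLarge-dominated (suc N) sN<q³ =
    subst (PrefixDominated (suc N)) (sym (roundedLarge-suc N))
          (PrefixDominated-++ N sN<q³ (roundedLarge-dominated N (ℕP.<-trans (ℕP.n<1+n N) sN<q³)))

  q³∸1<q³ : q ^ 3 ∸ 1 ℕ.< q ^ 3
  q³∸1<q³ = ℕP.∸-monoʳ-< ℕ.z<s (ℕ.>-nonZero⁻¹ (q ^ 3) {{ℕP.m^n≢0 q 3}})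

  smallItems : List (Fin n)
  smallItems = filter (λ i → s i ℚP.<? ε q) (allFin n)

  roundedLargeLength : ℕ
  roundedLargeLength = length (roundedLarge (q ^ 3 ∸ 1))

  matchedItems : List (Fin n)
  matchedItems = smallItems ++ firstItems roundedLargeLength

  rounded-dominated : Dominated s (rounded q s ord c) matchedItems
  rounded-dominated =
    Pointwise.++⁺ (map-dominated s smallItems) (proj₂ (roundedLarge-dominated (q ^ 3 ∸ 1) q³∸1<q³))

  Unique-matchedItems : Unique matchedItems
  Unique-matchedItems =
    Unique.++⁺ (Unique.filter⁺ _ (Unique.allFin⁺ n))
               (Unique.map⁺ (σ-inj _ _) (Unique-interval 0 roundedLargeLength))
               small∉large
    where
    small∉large : Disjoint smallItems (firstItems roundedLargeLength)
    small∉large (i∈small , i∈large) with ∈-map⁻ σ i∈large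
    ... | j , _ , refl = σ-large j (proj₂ (∈-filter⁻ (λ i → s i ℚP.<? ε q) {xs = allFin n} i∈small))

lemma9 : (n : ℕ) (s : Fin n → ℚ) → (∀ i → 0ℚ ≤ s i × s i ≤ 1ℚ) →
         (U : ℚ) .{{_ : Positive U}} → U ≤ 1ℚ →
         (k : ℕ) .{{_ : NonZero k}} →
         (q : ℕ) .{{_ : NonZero q}} →
         + (q ^ 2) ℤ.< floorKU k U ℤ.+ + k →
         (ord : LargeOrder q s) (c : ℕ → ℕ) → ClassSizes q (LargeOrder.ℓ ord) c →
         (m : ℕ) → Feasible U k s m →
         Feasible U k (lookup (rounded q s ord c)) m
lemma9 n s s∈[0,1] U _ k q _ ord c cs m =
  feasible-dominated U k s 0≤s rounded-dominated Unique-matchedItems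
  where
  0≤s : ∀ i → 0ℚ ≤ s i
  0≤s i = proj₁ (s∈[0,1] i)
  open LinearGrouping q s 0≤s ord c cs
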